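{- There are infinitely many odd integers $a>3$ such that $N=4a^2+1$ is square-free and $e=1$, where $e$ is the least positive integer such that $\epsilon^e\in\mathbb Z[\sqrt N]$, $\epsilon$ being the fundamental unit of the ring of integers of $\mathbb Q(\sqrt N)$.
   Context: For square-free $N>1$, the unit group of the ring of integers $\mathcal O_N$ of $\mathbb Q(\sqrt N)$ is $\{\pm1\}\times\langle\epsilon\rangle$ with fundamental unit $\epsilon>1$; the least $e\ge1$ with $\epsilon^e\in\mathbb Z[\sqrt N]$ satisfies $e\in\{1,3\}$. -}

module Defs where

open import Data.Nat as ℕ using (ℕ; _%_)
open import Data.Nat.Divisibility as ℕD using ()
open import Data.Integer as ℤ using (ℤ; +_; -_; _-_; _*_; _<_; _≤_)
open import Data.Integer.Divisibility as ℤD using ()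
open import Data.Product using (Σ; _×_; ∃-syntax)
open import Data.Sum using (_⊎_)
open import Relation.Binary.PropositionalEquality using (_≡_)

SquareFree : ℕ → Set
SquareFree n = ∀ d → (d ℕ.* d) ℕD.∣ n → d ≡ 1

-- Throughout, a pair (x , y) of integers stands for the real number
-- (x + y √N) / 2 in ℚ(√N) (N > 1 square-free, so √N is irrational).

-- "p + q √N > 0", decided exactly by integer arithmetic.
Positive : ℕ → ℤ → ℤ → Set
Positive N p q =
    (+ 0 < p × + 0 ≤ q)
  ⊎ (+ 0 ≤ p × + 0 < q)
  ⊎ (+ 0 < p × q < + 0 × (+ N * (q * q)) < p * p)
  ⊎ (p < + 0 × + 0 < q × p * p < (+ N * (q * q)))

-- (x + y √N)/2 lies in the ring of integers O_N of ℚ(√N):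
-- for N ≡ 1 (mod 4), O_N = { (x + y√N)/2 : x ≡ y (mod 2) };
-- otherwise O_N = ℤ[√N] = { (x + y√N)/2 : x, y even }.
InO : ℕ → ℤ → ℤ → Set
InO N x y = (N % 4 ≡ 1 × (+ 2) ℤD.∣ (x - y)) ⊎ ((+ 2) ℤD.∣ x × (+ 2) ℤD.∣ y)

InZ√ : ℤ → ℤ → Set
InZ√ x y = (+ 2) ℤD.∣ x × (+ 2) ℤD.∣ y

IsUnit : ℕ → ℤ → ℤ → Set
IsUnit N x y =
  InO N x y × ((x * x - + N * (y * y) ≡ + 4) ⊎ (x * x - + N * (y * y) ≡ - (+ 4)))

GtOne : ℕ → ℤ → ℤ → Set
GtOne N x y = Positive N (x - + 2) y

LeQ : ℕ → ℤ → ℤ → ℤ → ℤ → Set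
LeQ N x y u v = (x ≡ u × y ≡ v) ⊎ Positive N (u - x) (v - y)

IsFundamentalUnit : ℕ → ℤ → ℤ → Set
IsFundamentalUnit N x y =
  IsUnit N x y × GtOne N x y ×
  (∀ u v → IsUnit N u v → GtOne N u v → LeQ N x y u v)

module Submission where

-- Write n = 2a, so that N = 4a² + 1 = n² + 1 and ε = n + √N, i.e. the pair (2n , 2), is a unit
-- of norm −1 lying in ℤ[√N]. If (x + y√N)/2 > 1 is a unit then x ≥ 0 and y > 0, and
-- x² = N y² ± 4 = n² y² + y² ± 4 is pinned between consecutive squares: y = 1 is impossible,
-- y = 2 forces x = 2n, and y ≥ 3 gives x ≥ 2n. So ε is the fundamental unit as soon as n ≥ 3.
--
-- Odd a = 2j + 1 with N square-free are found by counting. For j < J, count the pairs (p , j)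
-- with p prime and p² ∣ f j = 4(2j + 1)² + 1. Since f j is odd and prime to 3, only primes
-- p ≡ ±1 (mod 6) occur. Two roots j, j′ of f modulo p² satisfy j ≡ j′ or j + j′ + 1 ≡ 0,
-- because f (j + d) − f j = 16 d (d + 2j + 1). Hence a prime p < R contributes at most
-- 2 (J/p² + 1) pairs, and Σ J/p² over odd p ≥ 5 is at most J/6 by telescoping. A prime with
-- p² ≥ 2J contributes at most one pair, and only if 5p² ≤ f j ≤ 16J², i.e. p ≤ 9J/5; at most
-- a third of those numbers are ≡ ±1 (mod 6). With R² = 4J the total is below J − K, so some
-- j ∈ [K, J) has f j square-free.

open import Defs
open import Data.Nat using (ℕ; zero; suc; _+_; _*_; _∸_; _<_; _≤_; _<?_; _≤?_; _≟_; z≤n; s≤s; z<s; _/_; _%_; NonZero; >-nonZero; ≢-nonZero; ≢-nonZero⁻¹)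
open import Data.Nat.Properties
open import Data.Nat.Divisibility
open import Data.Nat.DivMod
open import Data.Nat.Primality
open import Data.Nat.Primality.Factorisation using (factorise)
open import Data.Nat.ListAction using (product)
open import Data.Nat.Tactic.RingSolver using (solve-∀)
open import Data.Integer as ℤ using (+_; -[1+_]; +0)
import Data.Integer.Properties as ℤ
import Data.Integer.Tactic.RingSolver as ℤ
open import Data.List using ([]; _∷_)
open import Data.List.Relation.Unary.All using (_∷_)
open import Data.Product using (_,_; _×_; ∃-syntax; proj₁; proj₂)
open import Data.Sum using (_⊎_; inj₁; inj₂; [_,_]′)
open import Data.Empty using (⊥; ⊥-elim)
open import Function using (id)
open import Relation.Nullary using (¬_; Dec; yes; no)
open import Relation.Nullary.Decidable using (toWitnessFalse; _×-dec_; _⊎-dec_)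
open import Relation.Unary using (Decidable)
open import Relation.Binary.PropositionalEquality using (_≡_; refl; sym; trans; cong; cong₂; subst; subst₂; module ≡-Reasoning)
open import Relation.Binary.Definitions using (tri<; tri≈; tri>)

-- The fundamental unit of ℚ(√(n² + 1))

<-by : ∀ {x y} k → y ≡ x + suc k → x < y
<-by {x} k refl = m<m+n x z<s

≤-by : ∀ {x y} k → y ≡ x + k → x ≤ y
≤-by {x} k refl = m≤m+n x k

m*m≡n*n⇒m≡n : ∀ {m n} → m * m ≡ n * n → m ≡ n
m*m≡n*n⇒m≡n {m} {n} m²≡n² with <-cmp m n
... | tri< m<n _ _ = ⊥-elim (<-irrefl m²≡n² (*-mono-< m<n m<n))
... | tri≈ _ m≡n _ = m≡n
... | tri> _ _ n<m = ⊥-elim (<-irrefl (sym m²≡n²) (*-mono-< n<m n<m))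

¬square-between : ∀ c x → c * c < x * x → x * x < suc c * suc c → ⊥
¬square-between c x c²<x² x²<[1+c]² with c <? x
... | yes c<x = <⇒≱ x²<[1+c]² (*-mono-≤ c<x c<x)
... | no c≮x  = <⇒≱ c²<x² (*-mono-≤ (≮⇒≥ c≮x) (≮⇒≥ c≮x))

+m-+n≡+d⇒m≡n+d : ∀ {m n d} → + m ℤ.- + n ≡ + d → m ≡ n + d
+m-+n≡+d⇒m≡n+d {m} {n} {d} e = ℤ.+-injective (begin
  + m                      ≡⟨ add-back (+ m) (+ n) ⟩
  (+ m ℤ.- + n) ℤ.+ + n    ≡⟨ cong (ℤ._+ + n) e ⟩
  + (d + n)                ≡⟨ cong +_ (+-comm d n) ⟩
  + (n + d)                ∎)
  where
  open ≡-Reasoning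
  add-back : ∀ x y → x ≡ (x ℤ.- y) ℤ.+ y
  add-back = ℤ.solve-∀

+m-+n≡-+d⇒m+d≡n : ∀ {m n d} → + m ℤ.- + n ≡ ℤ.- + d → m + d ≡ n
+m-+n≡-+d⇒m+d≡n {m} {n} {d} e = ℤ.+-injective (begin
  + m ℤ.+ + d                        ≡⟨ add-back (+ m) (+ n) (+ d) ⟩
  ((+ m ℤ.- + n) ℤ.+ + d) ℤ.+ + n    ≡⟨ cong (λ t → (t ℤ.+ + d) ℤ.+ + n) e ⟩
  (ℤ.- + d ℤ.+ + d) ℤ.+ + n          ≡⟨ cancel (+ d) (+ n) ⟩
  + n                                ∎)
  where
  open ≡-Reasoning
  add-back : ∀ x y z → x ℤ.+ z ≡ ((x ℤ.- y) ℤ.+ z) ℤ.+ y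
  add-back = ℤ.solve-∀
  cancel : ∀ z y → (ℤ.- z ℤ.+ z) ℤ.+ y ≡ y
  cancel = ℤ.solve-∀

i*i≡+∣i∣*∣i∣ : ∀ i → i ℤ.* i ≡ + (ℤ.∣ i ∣ * ℤ.∣ i ∣)
i*i≡+∣i∣*∣i∣ (+ n)    = sym (ℤ.pos-* n n)
i*i≡+∣i∣*∣i∣ -[1+ n ] = refl

data Norm±4 (N x w : ℕ) : Set where
  norm≡4  : x * x ≡ N * w + 4 → Norm±4 N x w
  norm≡-4 : x * x + 4 ≡ N * w → Norm±4 N x w

norm±4 : ∀ N u v →
         (u ℤ.* u ℤ.- + N ℤ.* (v ℤ.* v) ≡ + 4) ⊎ (u ℤ.* u ℤ.- + N ℤ.* (v ℤ.* v) ≡ ℤ.- (+ 4)) →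
         Norm±4 N ℤ.∣ u ∣ (ℤ.∣ v ∣ * ℤ.∣ v ∣)
norm±4 N u v norm rewrite i*i≡+∣i∣*∣i∣ u | i*i≡+∣i∣*∣i∣ v | sym (ℤ.pos-* N (ℤ.∣ v ∣ * ℤ.∣ v ∣)) with norm
... | inj₁ e = norm≡4 (+m-+n≡+d⇒m≡n+d e)
... | inj₂ e = norm≡-4 (+m-+n≡-+d⇒m+d≡n e)

Norm±4⇒≤ : ∀ {N x w} → Norm±4 N x w → x * x ≤ N * w + 4
Norm±4⇒≤ (norm≡4 e) = ≤-reflexive e
Norm±4⇒≤ {N} {x} {w} (norm≡-4 e) = ≤-trans (≤-by 4 (sym e)) (m≤m+n (N * w) 4)

Norm±4⇒≥ : ∀ {N x w} → Norm±4 N x w → N * w ≤ x * x + 4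
Norm±4⇒≥ {N} {x} {w} (norm≡4 e) = ≤-trans (m≤m+n (N * w) 4) (≤-by 4 (cong (_+ 4) e))
Norm±4⇒≥ (norm≡-4 e) = ≤-reflexive (sym e)

¬unit>1-v≡0 : ∀ {N} n → Norm±4 N n 0 → ¬ Positive N (+ n ℤ.- + 2) +0
¬unit>1-v≡0 {N} (suc (suc (suc k))) norm (inj₁ _) =
  <⇒≱ 4<n² (subst (λ t → (3 + k) * (3 + k) ≤ t + 4) (*-zeroʳ N) (Norm±4⇒≤ norm))
  where
  3≤n : 3 ≤ 3 + k
  3≤n = m≤m+n 3 k
  4<n² : 4 < (3 + k) * (3 + k)
  4<n² = <-≤-trans (s≤s (s≤s (s≤s (s≤s (s≤s z≤n))))) (*-mono-≤ 3≤n 3≤n)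
¬unit>1-v≡0 0 _ (inj₁ (() , _))
¬unit>1-v≡0 1 _ (inj₁ (() , _))
¬unit>1-v≡0 2 _ (inj₁ (ℤ.+<+ () , _))
¬unit>1-v≡0 n _ (inj₂ (inj₁ (_ , ℤ.+<+ ())))
¬unit>1-v≡0 n _ (inj₂ (inj₂ (inj₁ (_ , ℤ.+<+ () , _))))
¬unit>1-v≡0 n _ (inj₂ (inj₂ (inj₂ (_ , ℤ.+<+ () , _))))

¬unit>1-v<0 : ∀ {N} n m → Norm±4 N n (suc m * suc m) → ¬ Positive N (+ n ℤ.- + 2) -[1+ m ]
¬unit>1-v<0 {N} (suc (suc (suc k))) m norm (inj₂ (inj₂ (inj₁ (_ , _ , Nv²<[u-2]²)))) =
  <⇒≱ (<-≤-trans (+-monoˡ-< 4 Nv²<[n-2]²) (≤-by (4 * k + 4) (expand k))) (Norm±4⇒≤ norm)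
  where
  expand : ∀ k → (3 + k) * (3 + k) ≡ (suc k * suc k + 4) + (4 * k + 4)
  expand = solve-∀
  Nv²<[n-2]² : N * (suc m * suc m) < suc k * suc k
  Nv²<[n-2]² = ℤ.drop‿+<+ (subst (ℤ._< _) (sym (ℤ.pos-* N (suc m * suc m))) Nv²<[u-2]²)
¬unit>1-v<0 0 m _ (inj₂ (inj₂ (inj₁ (() , _ , _))))
¬unit>1-v<0 1 m _ (inj₂ (inj₂ (inj₁ (() , _ , _))))
¬unit>1-v<0 2 m _ (inj₂ (inj₂ (inj₁ (ℤ.+<+ () , _ , _))))
¬unit>1-v<0 n m _ (inj₁ (_ , ()))
¬unit>1-v<0 n m _ (inj₂ (inj₁ (_ , ())))
¬unit>1-v<0 n m _ (inj₂ (inj₂ (inj₂ (_ , () , _))))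

¬unit>1-u<0 : ∀ {N} n v → Norm±4 N (suc n) (ℤ.∣ v ∣ * ℤ.∣ v ∣) → ¬ Positive N (-[1+ n ] ℤ.- + 2) v
¬unit>1-u<0 {N} n (+ suc m) norm (inj₂ (inj₂ (inj₂ (_ , _ , [u-2]²<Nv²)))) =
  <⇒≱ [n+3]²<Nv² (≤-trans (Norm±4⇒≥ norm) (≤-by (4 * n + 4) (expand n)))
  where
  expand : ∀ n → suc (suc (n + 1)) * suc (suc (n + 1)) ≡ (suc n * suc n + 4) + (4 * n + 4)
  expand = solve-∀
  [n+3]²<Nv² : suc (suc (n + 1)) * suc (suc (n + 1)) < N * (suc m * suc m)
  [n+3]²<Nv² = ℤ.drop‿+<+ (subst (_ ℤ.<_) (sym (ℤ.pos-* N (suc m * suc m))) [u-2]²<Nv²)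
¬unit>1-u<0 n +0 _ (inj₂ (inj₂ (inj₂ (_ , ℤ.+<+ () , _))))
¬unit>1-u<0 n -[1+ m ] _ (inj₂ (inj₂ (inj₂ (_ , () , _))))
¬unit>1-u<0 n v _ (inj₁ (() , _))
¬unit>1-u<0 n v _ (inj₂ (inj₁ (() , _)))
¬unit>1-u<0 n v _ (inj₂ (inj₂ (inj₁ (() , _ , _))))

unit>1⇒positive : ∀ N u v → Norm±4 N ℤ.∣ u ∣ (ℤ.∣ v ∣ * ℤ.∣ v ∣) → GtOne N u v →
                  ∃[ n ] ∃[ m ] (u ≡ + n × v ≡ + suc m)
unit>1⇒positive N (+ n) (+ suc m) _    _   = n , m , refl , refl
unit>1⇒positive N (+ n) +0        norm u>1 = ⊥-elim (¬unit>1-v≡0 n norm u>1)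
unit>1⇒positive N (+ n) -[1+ m ]  norm u>1 = ⊥-elim (¬unit>1-v<0 n m norm u>1)
unit>1⇒positive N -[1+ n ] v      norm u>1 = ⊥-elim (¬unit>1-u<0 n v norm u>1)

module _ (c : ℕ) where
  private
    n = 3 + c
    N = n * n + 1

  4N≡[2n]²+4 : N * 4 ≡ 2 * n * (2 * n) + 4
  4N≡[2n]²+4 = expand c
    where
    expand : ∀ c → ((3 + c) * (3 + c) + 1) * 4 ≡ 2 * (3 + c) * (2 * (3 + c)) + 4
    expand = solve-∀

  ¬Norm±4-v≡1 : ∀ {x} → ¬ Norm±4 N x 1
  ¬Norm±4-v≡1 {x} (norm≡4 e) = ¬square-between n x n²<x² x²<[n+1]²
    where
    x²≡n²+5 : x * x ≡ n * n + 5
    x²≡n²+5 = trans e (expand c)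
      where
      expand : ∀ c → ((3 + c) * (3 + c) + 1) * 1 + 4 ≡ (3 + c) * (3 + c) + 5
      expand = solve-∀
    n²<x² : n * n < x * x
    n²<x² = <-by 4 x²≡n²+5
    x²<[n+1]² : x * x < suc n * suc n
    x²<[n+1]² = <-by (2 * c + 1) (trans (expand c) (cong (_+ suc (2 * c + 1)) (sym x²≡n²+5)))
      where
      expand : ∀ c → (4 + c) * (4 + c) ≡ ((3 + c) * (3 + c) + 5) + suc (2 * c + 1)
      expand = solve-∀
  ¬Norm±4-v≡1 {x} (norm≡-4 e) = ¬square-between (2 + c) x [n-1]²<x² x²<n²
    where
    x²+3≡n² : x * x + 3 ≡ n * n
    x²+3≡n² = +-cancelʳ-≡ 1 _ _ (trans (+-assoc (x * x) 3 1) (trans e (*-identityʳ N)))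
    [n-1]²<x² : (2 + c) * (2 + c) < x * x
    [n-1]²<x² = <-by (2 * c + 1) (+-cancelʳ-≡ 3 _ _ (trans x²+3≡n² (expand c)))
      where
      expand : ∀ c → (3 + c) * (3 + c) ≡ ((2 + c) * (2 + c) + suc (2 * c + 1)) + 3
      expand = solve-∀
    x²<n² : x * x < suc (2 + c) * suc (2 + c)
    x²<n² = <-by 2 (sym x²+3≡n²)

  Norm±4-v≡2⇒x≡2n : ∀ {x} → Norm±4 N x 4 → x ≡ 2 * n
  Norm±4-v≡2⇒x≡2n {x} (norm≡4 e) = ⊥-elim (¬square-between (2 * n) x [2n]²<x² x²<[2n+1]²)
    where
    x²≡[2n]²+4+4 : x * x ≡ 2 * n * (2 * n) + 4 + 4
    x²≡[2n]²+4+4 = trans e (cong (_+ 4) 4N≡[2n]²+4)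
    [2n]²<x² : 2 * n * (2 * n) < x * x
    [2n]²<x² = <-by 7 (trans x²≡[2n]²+4+4 (+-assoc (2 * n * (2 * n)) 4 4))
    x²<[2n+1]² : x * x < suc (2 * n) * suc (2 * n)
    x²<[2n+1]² = <-by (4 * c + 4) (trans (expand c) (cong (_+ suc (4 * c + 4)) (sym x²≡[2n]²+4+4)))
      where
      expand : ∀ c → suc (2 * (3 + c)) * suc (2 * (3 + c)) ≡ (2 * (3 + c) * (2 * (3 + c)) + 4 + 4) + suc (4 * c + 4)
      expand = solve-∀
  Norm±4-v≡2⇒x≡2n {x} (norm≡-4 e) = m*m≡n*n⇒m≡n (+-cancelʳ-≡ 4 _ _ (trans e 4N≡[2n]²+4))

  Norm±4-v≥3⇒2n≤x : ∀ {x} k → Norm±4 N x ((3 + k) * (3 + k)) → 2 * n ≤ x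
  Norm±4-v≥3⇒2n≤x {x} k norm with 2 * n ≤? x
  ... | yes 2n≤x = 2n≤x
  ... | no 2n≰x  = ⊥-elim (<⇒≱ (+-monoˡ-< 4 (*-mono-< x<2n x<2n)) (≤-trans [2n]²+4≤Nv² (Norm±4⇒≥ norm)))
    where
    x<2n = ≰⇒> 2n≰x
    [2n]²+4≤Nv² : 2 * n * (2 * n) + 4 ≤ N * ((3 + k) * (3 + k))
    [2n]²+4≤Nv² = ≤-by (5 * N + N * (k * (6 + k))) (expand c k)
      where
      expand : ∀ c k → ((3 + c) * (3 + c) + 1) * ((3 + k) * (3 + k))
               ≡ (2 * (3 + c) * (2 * (3 + c)) + 4) + (5 * ((3 + c) * (3 + c) + 1) + ((3 + c) * (3 + c) + 1) * (k * (6 + k)))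
      expand = solve-∀

fundamentalUnit : ∀ n → 3 ≤ n → IsFundamentalUnit (n * n + 1) (+ (2 * n)) (+ 2)
fundamentalUnit .(3 + c) (s≤s (s≤s (s≤s {n = c} _))) = isUnit , ε>1 , minimal
  where
  n = 3 + c
  N = n * n + 1

  isUnit : IsUnit N (+ (2 * n)) (+ 2)
  isUnit = inj₂ (divides n (*-comm 2 n) , divides 1 refl) , inj₂ (begin
    + (2 * n) ℤ.* + (2 * n) ℤ.- + N ℤ.* (+ 2 ℤ.* + 2)     ≡⟨ cong₂ ℤ._-_ (sym (ℤ.pos-* (2 * n) (2 * n))) (sym (ℤ.pos-* N 4)) ⟩
    + (2 * n * (2 * n)) ℤ.- + (N * 4)                     ≡⟨ cong (λ t → + (2 * n * (2 * n)) ℤ.- + t) (4N≡[2n]²+4 c) ⟩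
    + (2 * n * (2 * n)) ℤ.- (+ (2 * n * (2 * n)) ℤ.+ + 4) ≡⟨ x-[x+4] (+ (2 * n * (2 * n))) ⟩
    ℤ.- (+ 4)                                             ∎)
    where
    open ≡-Reasoning
    x-[x+4] : ∀ x → x ℤ.- (x ℤ.+ + 4) ≡ ℤ.- (+ 4)
    x-[x+4] = ℤ.solve-∀

  ε>1 : GtOne N (+ (2 * n)) (+ 2)
  ε>1 = inj₁ (ℤ.+<+ z<s , ℤ.+≤+ z≤n)

  minimal : ∀ u v → IsUnit N u v → GtOne N u v → LeQ N (+ (2 * n)) (+ 2) u v
  minimal u v (_ , norm) u>1 with unit>1⇒positive N u v (norm±4 N u v norm) u>1
  ... | x , zero , refl , refl = ⊥-elim (¬Norm±4-v≡1 c (norm±4 N (+ x) (+ 1) norm))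
  ... | x , suc zero , refl , refl = inj₁ (cong +_ (sym (Norm±4-v≡2⇒x≡2n c (norm±4 N (+ x) (+ 2) norm))) , refl)
  ... | x , suc (suc k) , refl , refl =
    inj₂ (inj₂ (inj₁ (ℤ.i≤j⇒0≤j-i (ℤ.+≤+ (Norm±4-v≥3⇒2n≤x c k (norm±4 N (+ x) (+ (3 + k)) norm))) , ℤ.+<+ z<s)))

-- Finite sums and counting

∑ : ℕ → (ℕ → ℕ) → ℕ
∑ zero    g = 0
∑ (suc n) g = ∑ n g + g n

𝟙 : ∀ {P : Set} → Dec P → ℕ
𝟙 (yes _) = 1
𝟙 (no _)  = 0

module _ {P : Set} where

  𝟙≤1 : (d : Dec P) → 𝟙 d ≤ 1
  𝟙≤1 (yes _) = ≤-refl
  𝟙≤1 (no _)  = z≤n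

  𝟙-yes : (d : Dec P) → P → 𝟙 d ≡ 1
  𝟙-yes (yes _) _ = refl
  𝟙-yes (no ¬p) p = ⊥-elim (¬p p)

  𝟙-no : (d : Dec P) → ¬ P → 𝟙 d ≡ 0
  𝟙-no (yes p) ¬p = ⊥-elim (¬p p)
  𝟙-no (no _)  _  = refl

  𝟙>0⇒ : (d : Dec P) → 0 < 𝟙 d → P
  𝟙>0⇒ (yes p) _ = p

  𝟙≤𝟙 : ∀ {Q : Set} → (P → Q) → (d : Dec P) (e : Dec Q) → 𝟙 d ≤ 𝟙 e
  𝟙≤𝟙 _   (no _)  _       = z≤n
  𝟙≤𝟙 _   (yes _) (yes _) = ≤-refl
  𝟙≤𝟙 P⇒Q (yes p) (no ¬q) = ⊥-elim (¬q (P⇒Q p))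

𝟙-⊎ : ∀ {P Q R : Set} → (P → Q ⊎ R) → (p? : Dec P) (q? : Dec Q) (r? : Dec R) → 𝟙 p? ≤ 𝟙 q? + 𝟙 r?
𝟙-⊎ _ (no _) _ _ = z≤n
𝟙-⊎ P⇒Q⊎R (yes p) q? r? with P⇒Q⊎R p
... | inj₁ q = ≤-trans (≤-reflexive (sym (𝟙-yes q? q))) (m≤m+n _ _)
... | inj₂ r = ≤-trans (≤-reflexive (sym (𝟙-yes r? r))) (m≤n+m _ _)

∑-mono-≤ : ∀ n {g h} → (∀ i → i < n → g i ≤ h i) → ∑ n g ≤ ∑ n h
∑-mono-≤ zero    _   = z≤n
∑-mono-≤ (suc n) g≤h = +-mono-≤ (∑-mono-≤ n (λ i i<n → g≤h i (m<n⇒m<1+n i<n))) (g≤h n ≤-refl)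

∑-≤-const : ∀ n {g c} → (∀ i → i < n → g i ≤ c) → ∑ n g ≤ n * c
∑-≤-const zero    _   = z≤n
∑-≤-const (suc n) {g} {c} g≤c =
  subst (∑ n g + g n ≤_) (+-comm (n * c) c) (+-mono-≤ (∑-≤-const n (λ i i<n → g≤c i (m<n⇒m<1+n i<n))) (g≤c n ≤-refl))

∑-zero : ∀ n {g} → (∀ i → i < n → g i ≡ 0) → ∑ n g ≡ 0
∑-zero zero    _    = refl
∑-zero (suc n) g≡0 = cong₂ _+_ (∑-zero n (λ i i<n → g≡0 i (m<n⇒m<1+n i<n))) (g≡0 n ≤-refl)

∑≡0⇒ : ∀ n {g} → ∑ n g ≡ 0 → ∀ i → i < n → g i ≡ 0
∑≡0⇒ (suc n) {g} ∑≡0 i i<1+n with m<1+n⇒m<n∨m≡n i<1+n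
... | inj₁ i<n  = ∑≡0⇒ n (m+n≡0⇒m≡0 _ ∑≡0) i i<n
... | inj₂ refl = m+n≡0⇒n≡0 (∑ n g) ∑≡0

∑>0⇒ : ∀ n {g} → 0 < ∑ n g → ∃[ i ] (i < n × 0 < g i)
∑>0⇒ (suc n) {g} ∑>0 with g n in eq
... | suc _ = n , ≤-refl , subst (0 <_) (sym eq) z<s
... | zero with ∑>0⇒ n (subst (0 <_) (+-identityʳ _) ∑>0)
...   | i , i<n , gi>0 = i , m<n⇒m<1+n i<n , gi>0

∑-+ : ∀ n g h → ∑ n (λ i → g i + h i) ≡ ∑ n g + ∑ n h
∑-+ zero    g h = refl
∑-+ (suc n) g h rewrite ∑-+ n g h = interchange (∑ n g) (∑ n h) (g n) (h n)
  where
  interchange : ∀ a b c d → a + b + (c + d) ≡ a + c + (b + d)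
  interchange = solve-∀

∑-*ˡ : ∀ n c g → ∑ n (λ i → c * g i) ≡ c * ∑ n g
∑-*ˡ zero    c g = sym (*-zeroʳ c)
∑-*ˡ (suc n) c g rewrite ∑-*ˡ n c g = sym (*-distribˡ-+ c (∑ n g) (g n))

∑-swap : ∀ n m (F : ℕ → ℕ → ℕ) → ∑ n (λ i → ∑ m (F i)) ≡ ∑ m (λ j → ∑ n (λ i → F i j))
∑-swap zero    m F = sym (∑-zero m (λ _ _ → refl))
∑-swap (suc n) m F rewrite ∑-swap n m F = sym (∑-+ m (λ j → ∑ n (λ i → F i j)) (F n))

∑-++ : ∀ a b g → ∑ (a + b) g ≡ ∑ a g + ∑ b (λ i → g (a + i))
∑-++ a zero    g rewrite +-identityʳ a = sym (+-identityʳ _)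
∑-++ a (suc b) g rewrite +-suc a b | ∑-++ a b g = +-assoc (∑ a g) _ _

∑-mono-≤-range : ∀ {m n} g → m ≤ n → ∑ m g ≤ ∑ n g
∑-mono-≤-range {m} {n} g m≤n = begin
  ∑ m g                                 ≤⟨ m≤m+n (∑ m g) _ ⟩
  ∑ m g + ∑ (n ∸ m) (λ i → g (m + i))   ≡⟨ ∑-++ m (n ∸ m) g ⟨
  ∑ (m + (n ∸ m)) g                     ≡⟨ cong (λ k → ∑ k g) (m+[n∸m]≡n m≤n) ⟩
  ∑ n g                                 ∎
  where open ≤-Reasoning

∑-truncate : ∀ n L g → (∀ i → L ≤ i → g i ≡ 0) → ∑ n g ≤ ∑ L g
∑-truncate n L g vanishes with n ≤? L
... | yes n≤L = ∑-mono-≤-range g n≤L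
... | no n≰L = ≤-reflexive (begin
  ∑ n g                                  ≡⟨ cong (λ k → ∑ k g) (m+[n∸m]≡n L≤n) ⟨
  ∑ (L + (n ∸ L)) g                      ≡⟨ ∑-++ L (n ∸ L) g ⟩
  ∑ L g + ∑ (n ∸ L) (λ i → g (L + i))    ≡⟨ cong (_+_ (∑ L g)) (∑-zero (n ∸ L) (λ i _ → vanishes (L + i) (m≤m+n L i))) ⟩
  ∑ L g + 0                              ≡⟨ +-identityʳ _ ⟩
  ∑ L g                                  ∎)
  where
  open ≡-Reasoning
  L≤n = <⇒≤ (≰⇒> n≰L)

count : ∀ {P : ℕ → Set} → Decidable P → ℕ → ℕ
count P? n = ∑ n (λ i → 𝟙 (P? i))

count-<-≤ : ∀ L n → count (_<? L) n ≤ L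
count-<-≤ L n = begin
  count (_<? L) n  ≤⟨ ∑-truncate n L _ (λ i L≤i → 𝟙-no (i <? L) (≤⇒≯ L≤i)) ⟩
  count (_<? L) L  ≤⟨ ∑-≤-const L (λ i _ → 𝟙≤1 (i <? L)) ⟩
  L * 1            ≡⟨ *-identityʳ L ⟩
  L                ∎
  where open ≤-Reasoning

∃-zero-beyond : ∀ K n g → ∑ n g + K < n → ∃[ i ] (K ≤ i × i < n × g i ≡ 0)
∃-zero-beyond K (suc n) g bound with g n in gn≡ | K ≤? n
... | zero  | yes K≤n = n , K≤n , ≤-refl , gn≡
... | zero  | no K≰n = ⊥-elim (<⇒≱ bound (begin
  suc n             ≤⟨ ≰⇒> K≰n ⟩
  K                 ≤⟨ m≤n+m K _ ⟩
  ∑ n g + 0 + K     ∎))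
  where open ≤-Reasoning
... | suc v | _ with ∃-zero-beyond K n g (≤-trans (+-monoˡ-≤ K (m<m+n (∑ n g) z<s)) (≤-pred bound))
...   | i , K≤i , i<n , gi≡0 = i , K≤i , m<n⇒m<1+n i<n , gi≡0

module _ {P : ℕ → Set} (P? : Decidable P) where

  count≤1 : ∀ n → (∀ {i j} → i < n → j < n → P i → P j → i ≡ j) → count P? n ≤ 1
  count≤1 zero    _      = z≤n
  count≤1 (suc n) unique with P? n
  ... | no _ = subst (_≤ 1) (sym (+-identityʳ _)) (count≤1 n (λ i<n j<n → unique (m<n⇒m<1+n i<n) (m<n⇒m<1+n j<n)))
  ... | yes pn = subst (_≤ 1) (cong (_+ 1) (sym before-n)) ≤-refl
    where
    before-n : count P? n ≡ 0
    before-n = ∑-zero n (λ i i<n → 𝟙-no (P? i) (λ pi → <⇒≢ i<n (unique (m<n⇒m<1+n i<n) ≤-refl pi pn)))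

Separated : ℕ → (ℕ → Set) → Set
Separated M P = ∀ {i j} → P i → P j → i < j → i + M ≤ j

module _ {P : ℕ → Set} (P? : Decidable P) {M} (separated : Separated M P) where

  count-window≤1 : ∀ s → count (λ i → P? (s + i)) M ≤ 1
  count-window≤1 s = count≤1 (λ i → P? (s + i)) M unique
    where
    apart : ∀ {i j} → j < M → P (s + i) → P (s + j) → ¬ i < j
    apart {i} {j} j<M pi pj i<j = <⇒≱ j<M (+-cancelˡ-≤ (s + i) M j (begin
      s + i + M  ≤⟨ separated pi pj (+-monoʳ-< s i<j) ⟩
      s + j      ≤⟨ +-monoˡ-≤ j (m≤m+n s i) ⟩
      s + i + j  ∎))
      where open ≤-Reasoning
    unique : ∀ {i j} → i < M → j < M → P (s + i) → P (s + j) → i ≡ j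
    unique {i} {j} i<M j<M pi pj with <-cmp i j
    ... | tri< i<j _ _ = ⊥-elim (apart j<M pi pj i<j)
    ... | tri≈ _ i≡j _ = i≡j
    ... | tri> _ _ j<i = ⊥-elim (apart i<M pj pi j<i)

  count-separated-multiple : ∀ k → count P? (k * M) ≤ k
  count-separated-multiple zero    = z≤n
  count-separated-multiple (suc k) = begin
    count P? (suc k * M)                                ≡⟨ cong (count P?) (+-comm M (k * M)) ⟩
    count P? (k * M + M)                                ≡⟨ ∑-++ (k * M) M _ ⟩
    count P? (k * M) + count (λ i → P? (k * M + i)) M   ≤⟨ +-mono-≤ (count-separated-multiple k) (count-window≤1 (k * M)) ⟩
    k + 1                                               ≡⟨ +-comm k 1 ⟩
    suc k                                               ∎
    where open ≤-Reasoning

  count-separated : .{{_ : NonZero M}} → ∀ n → count P? n ≤ n / M + 1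
  count-separated n = begin
    count P? n                  ≤⟨ ∑-mono-≤-range _ n≤[n/M+1]*M ⟩
    count P? ((n / M + 1) * M)  ≤⟨ count-separated-multiple (n / M + 1) ⟩
    n / M + 1                   ∎
    where
    open ≤-Reasoning
    n≤[n/M+1]*M : n ≤ (n / M + 1) * M
    n≤[n/M+1]*M = begin
      n                    ≡⟨ m≡m%n+[m/n]*n n M ⟩
      n % M + n / M * M    ≤⟨ +-monoˡ-≤ (n / M * M) (<⇒≤ (m%n<n n M)) ⟩
      M + n / M * M        ≡⟨ regroup (n / M) M ⟩
      (n / M + 1) * M      ∎
      where
      regroup : ∀ q M → M + q * M ≡ (q + 1) * M
      regroup = solve-∀

%-separated : ∀ {M} .{{_ : NonZero M}} {i j} → i % M ≡ j % M → i < j → i + M ≤ j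
%-separated {M} {i} {j} i≡j i<j = begin
  i + M        ≤⟨ +-monoʳ-≤ i (∣⇒≤ {{>-nonZero (m<n⇒0<n∸m i<j)}} M∣j∸i) ⟩
  i + (j ∸ i)  ≡⟨ m+[n∸m]≡n (<⇒≤ i<j) ⟩
  j            ∎
  where
  open ≤-Reasoning
  M∣j∸i : M ∣ j ∸ i
  M∣j∸i = divides (j / M ∸ i / M) (begin-equality
    j ∸ i                                    ≡⟨ cong₂ _∸_ (m≡m%n+[m/n]*n j M) (m≡m%n+[m/n]*n i M) ⟩
    (j % M + j / M * M) ∸ (i % M + i / M * M) ≡⟨ cong (λ r → (r + j / M * M) ∸ (i % M + i / M * M)) (sym i≡j) ⟩
    (i % M + j / M * M) ∸ (i % M + i / M * M) ≡⟨ [m+n]∸[m+o]≡n∸o (i % M) _ _ ⟩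
    j / M * M ∸ i / M * M                     ≡⟨ *-distribʳ-∸ M (j / M) (i / M) ⟨
    (j / M ∸ i / M) * M                       ∎)

%-separated-shift : ∀ {M} .{{_ : NonZero M}} c {i j} → (i + c) % M ≡ (j + c) % M → i < j → i + M ≤ j
%-separated-shift {M} c {i} {j} i≡j i<j =
  +-cancelʳ-≤ c (i + M) j (≤-trans (≤-reflexive (swap i M c)) (%-separated i≡j (+-monoˡ-< c i<j)))
  where
  swap : ∀ i M c → i + M + c ≡ i + c + M
  swap = solve-∀

-- Primes and square divisors of f j = 4 (2j + 1)² + 1

∣prime⇒≡ : ∀ {p d} → Prime p → d ∣ p → 1 < d → d ≡ p
∣prime⇒≡ pr d∣p 1<d = [ (λ d≡1 → ⊥-elim (<⇒≢ 1<d (sym d≡1))) , id ]′ (prime⇒irreducible pr d∣p)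

prime⇒p*p≢0 : ∀ {p} → Prime p → NonZero (p * p)
prime⇒p*p≢0 {p} pr = m*n≢0 p p {{prime⇒nonZero pr}} {{prime⇒nonZero pr}}

UnitMod6 : ℕ → Set
UnitMod6 p = p % 6 ≡ 1 ⊎ p % 6 ≡ 5

∣m%n∧∣n⇒∣m : ∀ {d} m n .{{_ : NonZero n}} → d ∣ m % n → d ∣ n → d ∣ m
∣m%n∧∣n⇒∣m {d} m n d∣m%n d∣n = subst (d ∣_) (sym (m≡m%n+[m/n]*n m n)) (∣m∣n⇒∣m+n d∣m%n (∣n⇒∣m*n (m / n) d∣n))

prime-mod6 : ∀ {p} → Prime p → p ≡ 2 ⊎ p ≡ 3 ⊎ UnitMod6 p
prime-mod6 {p} pr = classify (p % 6) refl (m%n<n p 6)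
  where
  divisor : ∀ {d} r → p % 6 ≡ r → d ∣ r → d ∣ 6 → 1 < d → p ≡ d
  divisor {d} r p%6≡r d∣r d∣6 1<d =
    sym (∣prime⇒≡ pr (∣m%n∧∣n⇒∣m p 6 (subst (d ∣_) (sym p%6≡r) d∣r) d∣6) 1<d)
  classify : ∀ r → p % 6 ≡ r → r < 6 → p ≡ 2 ⊎ p ≡ 3 ⊎ UnitMod6 p
  classify 0 e _ = inj₁ (divisor 0 e (divides 0 refl) (divides 3 refl) ≤-refl)
  classify 1 e _ = inj₂ (inj₂ (inj₁ e))
  classify 2 e _ = inj₁ (divisor 2 e (divides 1 refl) (divides 3 refl) ≤-refl)
  classify 3 e _ = inj₂ (inj₁ (divisor 3 e (divides 1 refl) (divides 2 refl) (s≤s (s≤s z≤n))))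
  classify 4 e _ = inj₁ (divisor 4 e (divides 2 refl) (divides 3 refl) ≤-refl)
  classify 5 e _ = inj₂ (inj₂ (inj₂ e))
  classify (suc (suc (suc (suc (suc (suc _)))))) _ (s≤s (s≤s (s≤s (s≤s (s≤s (s≤s ()))))))

unitMod6⇒odd : ∀ {p} → UnitMod6 p → p % 2 ≡ 1
unitMod6⇒odd {p} u = trans (sym (m∣n⇒o%n%m≡o%m 2 6 p (divides 3 refl))) (odd-residue u)
  where
  odd-residue : UnitMod6 p → p % 6 % 2 ≡ 1
  odd-residue (inj₁ e) = cong (_% 2) e
  odd-residue (inj₂ e) = cong (_% 2) e

unitMod6∧prime⇒5≤p : ∀ {p} → Prime p → UnitMod6 p → 5 ≤ p
unitMod6∧prime⇒5≤p {0} _ (inj₁ ())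
unitMod6∧prime⇒5≤p {0} _ (inj₂ ())
unitMod6∧prime⇒5≤p {1} pr _ = ⊥-elim (¬prime[1] pr)
unitMod6∧prime⇒5≤p {2} _ (inj₁ ())
unitMod6∧prime⇒5≤p {2} _ (inj₂ ())
unitMod6∧prime⇒5≤p {3} _ (inj₁ ())
unitMod6∧prime⇒5≤p {3} _ (inj₂ ())
unitMod6∧prime⇒5≤p {4} _ (inj₁ ())
unitMod6∧prime⇒5≤p {4} _ (inj₂ ())
unitMod6∧prime⇒5≤p {suc (suc (suc (suc (suc _))))} _ _ = s≤s (s≤s (s≤s (s≤s (s≤s z≤n))))

f : ℕ → ℕ
f j = 4 * (suc (2 * j) * suc (2 * j)) + 1

2∤f : ∀ j → ¬ 2 ∣ f j
2∤f j 2∣fj = <⇒≢ (s≤s ≤-refl) (sym (∣1⇒≡1 2∣1))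
  where
  expand : ∀ j → 4 * (suc (2 * j) * suc (2 * j)) + 1 ≡ 2 * (2 * (suc (2 * j) * suc (2 * j))) + 1
  expand = solve-∀
  2∣1 : 2 ∣ 1
  2∣1 = ∣m+n∣m⇒∣n (subst (2 ∣_) (expand j) 2∣fj) (m∣m*n (2 * (suc (2 * j) * suc (2 * j))))

f≢0 : ∀ j → NonZero (f j)
f≢0 j = ≢-nonZero (λ fj≡0 → 2∤f j (subst (2 ∣_) (sym fj≡0) (divides 0 refl)))

3∤f : ∀ j → ¬ 3 ∣ f j
3∤f 0 = toWitnessFalse {a? = 3 ∣? 5} _
3∤f 1 = toWitnessFalse {a? = 3 ∣? 37} _
3∤f 2 = toWitnessFalse {a? = 3 ∣? 101} _
3∤f (suc (suc (suc j))) 3∣f = 3∤f j (∣m+n∣m⇒∣n (subst (3 ∣_) (period j) 3∣f) (m∣m*n (32 * j + 64)))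
  where
  period : ∀ j → 4 * (suc (2 * (3 + j)) * suc (2 * (3 + j))) + 1 ≡ 3 * (32 * j + 64) + (4 * (suc (2 * j) * suc (2 * j)) + 1)
  period = solve-∀

f-mono-≤ : ∀ {i j} → i ≤ j → f i ≤ f j
f-mono-≤ i≤j = +-monoˡ-≤ 1 (*-monoʳ-≤ 4 (*-mono-≤ 2i+1≤2j+1 2i+1≤2j+1))
  where 2i+1≤2j+1 = s≤s (*-monoʳ-≤ 2 i≤j)

f<16J² : ∀ {j J} → j < J → f j ≤ 16 * (J * J)
f<16J² {j} {suc J} (s≤s j≤J) = ≤-trans (f-mono-≤ j≤J) (≤-by (16 * J + 11) (expand J))
  where
  expand : ∀ J → 16 * (suc J * suc J) ≡ (4 * (suc (2 * J) * suc (2 * J)) + 1) + (16 * J + 11)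
  expand = solve-∀

-- The cofactor of p² is not 1 (f j is one more than a square), 2 or 4 (f j is odd) or 3.
p²∣f⇒5p²≤f : ∀ {p} j → p * p ∣ f j → 5 * (p * p) ≤ f j
p²∣f⇒5p²≤f j (divides 0 fj≡0) with m+n≡0⇒n≡0 (4 * (suc (2 * j) * suc (2 * j))) fj≡0
... | ()
p²∣f⇒5p²≤f {p} j (divides 1 fj≡p²) = ⊥-elim (¬square-between (2 * suc (2 * j)) p [2a]²<p² p²<[2a+1]²)
  where
  p²≡[2a]²+1 : p * p ≡ 2 * suc (2 * j) * (2 * suc (2 * j)) + 1
  p²≡[2a]²+1 = trans (sym (trans fj≡p² (+-identityʳ (p * p)))) (expand j)
    where
    expand : ∀ j → 4 * (suc (2 * j) * suc (2 * j)) + 1 ≡ 2 * suc (2 * j) * (2 * suc (2 * j)) + 1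
    expand = solve-∀
  [2a]²<p² = <-by 0 p²≡[2a]²+1
  p²<[2a+1]² = <-by (8 * j + 3) (trans (expand j) (cong (_+ suc (8 * j + 3)) (sym p²≡[2a]²+1)))
    where
    expand : ∀ j → suc (2 * suc (2 * j)) * suc (2 * suc (2 * j)) ≡ (2 * suc (2 * j) * (2 * suc (2 * j)) + 1) + suc (8 * j + 3)
    expand = solve-∀
p²∣f⇒5p²≤f {p} j (divides 2 fj≡2p²) = ⊥-elim (2∤f j (divides (p * p) (trans fj≡2p² (*-comm 2 (p * p)))))
p²∣f⇒5p²≤f {p} j (divides 3 fj≡3p²) = ⊥-elim (3∤f j (divides (p * p) (trans fj≡3p² (*-comm 3 (p * p)))))
p²∣f⇒5p²≤f {p} j (divides 4 fj≡4p²) = ⊥-elim (2∤f j (divides (2 * (p * p)) (trans fj≡4p² (regroup (p * p)))))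
  where
  regroup : ∀ x → 4 * x ≡ 2 * x * 2
  regroup = solve-∀
p²∣f⇒5p²≤f {p} j (divides (suc (suc (suc (suc (suc k))))) fj≡kp²) =
  subst (5 * (p * p) ≤_) (sym fj≡kp²) (*-monoˡ-≤ (p * p) (m≤m+n 5 k))

5p²≤16J²⇒5p≤9J : ∀ {p J} → 5 * (p * p) ≤ 16 * (J * J) → 5 * p ≤ 9 * J
5p²≤16J²⇒5p≤9J {p} {J} 5p²≤16J² with 5 * p ≤? 9 * J
... | yes 5p≤9J = 5p≤9J
... | no 5p≰9J = ⊥-elim (<⇒≱ (≤-<-trans 25p²≤80J² 80J²<[9J+1]²) (*-mono-≤ 9J<5p 9J<5p))
  where
  open ≤-Reasoning
  9J<5p = ≰⇒> 5p≰9J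
  25p²≤80J² : 5 * p * (5 * p) ≤ 5 * (16 * (J * J))
  25p²≤80J² = begin
    5 * p * (5 * p)     ≡⟨ regroup p ⟩
    5 * (5 * (p * p))   ≤⟨ *-monoʳ-≤ 5 5p²≤16J² ⟩
    5 * (16 * (J * J))  ∎
    where
    regroup : ∀ p → 5 * p * (5 * p) ≡ 5 * (5 * (p * p))
    regroup = solve-∀
  80J²<[9J+1]² : 5 * (16 * (J * J)) < suc (9 * J) * suc (9 * J)
  80J²<[9J+1]² = <-by (J * J + 18 * J) (expand J)
    where
    expand : ∀ J → suc (9 * J) * suc (9 * J) ≡ 5 * (16 * (J * J)) + suc (J * J + 18 * J)
    expand = solve-∀

p²∣m*n⇒p²∣m : ∀ {p m n} → Prime p → ¬ p ∣ n → p * p ∣ m * n → p * p ∣ m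
p²∣m*n⇒p²∣m {p} {m} {n} pr p∤n p²∣mn with euclidsLemma m n pr (∣-trans (m∣m*n p) p²∣mn)
... | inj₂ p∣n = ⊥-elim (p∤n p∣n)
... | inj₁ (divides e refl) = *-monoˡ-∣ p p∣e
  where
  p∣e*n : p ∣ e * n
  p∣e*n = *-cancelʳ-∣ p {{prime⇒nonZero pr}} (subst (p * p ∣_) (swap e p n) p²∣mn)
    where
    swap : ∀ e p n → e * p * n ≡ e * n * p
    swap = solve-∀
  p∣e : p ∣ e
  p∣e = [ id , (λ p∣n → ⊥-elim (p∤n p∣n)) ]′ (euclidsLemma e n pr p∣e*n)

f-shift : ∀ j d → f (j + d) ≡ f j + 16 * (d * (d + suc (2 * j)))
f-shift = expand
  where
  expand : ∀ j d → 4 * (suc (2 * (j + d)) * suc (2 * (j + d))) + 1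
                 ≡ (4 * (suc (2 * j) * suc (2 * j)) + 1) + 16 * (d * (d + suc (2 * j)))
  expand = solve-∀

module _ {p} (pr : Prime p) (2<p : 2 < p) where

  private
    instance
      p²≢0 : NonZero (p * p)
      p²≢0 = prime⇒p*p≢0 pr

    p∤2 : ¬ p ∣ 2
    p∤2 p∣2 = <⇒≱ 2<p (∣⇒≤ p∣2)

    p²∣16m⇒p²∣m : ∀ {m} → p * p ∣ 16 * m → p * p ∣ m
    p²∣16m⇒p²∣m {m} p²∣16m = halve (halve (halve (halve (subst (p * p ∣_) (as-product m) p²∣16m))))
      where
      halve : ∀ {x} → p * p ∣ x * 2 → p * p ∣ x
      halve = p²∣m*n⇒p²∣m pr p∤2
      as-product : ∀ m → 16 * m ≡ m * 2 * 2 * 2 * 2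
      as-product = solve-∀

  -- p divides at most one of d and d + 2j + 1, as p ∣ 2j + 1 would give p ∣ f j − 4(2j + 1)² = 1.
  roots-apart : ∀ j d → p * p ∣ f j → p * p ∣ f (j + d) → p * p ∣ d ⊎ p * p ∣ d + suc (2 * j)
  roots-apart j d p²∣fj p²∣fj+d = split (p ∣? d)
    where
    p²∣product : p * p ∣ d * (d + suc (2 * j))
    p²∣product = p²∣16m⇒p²∣m (∣m+n∣m⇒∣n (subst (p * p ∣_) (f-shift j d) p²∣fj+d) p²∣fj)
    p∤1 : ¬ p ∣ 1
    p∤1 p∣1 = ¬prime[1] (subst Prime (∣1⇒≡1 p∣1) pr)
    split : Dec (p ∣ d) → p * p ∣ d ⊎ p * p ∣ d + suc (2 * j)
    split (yes p∣d) = inj₁ (p²∣m*n⇒p²∣m pr p∤d+2j+1 p²∣product)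
      where
      p∤d+2j+1 : ¬ p ∣ d + suc (2 * j)
      p∤d+2j+1 p∣d+2j+1 = p∤1 (∣m+n∣m⇒∣n (∣-trans (m∣m*n p) p²∣fj) (∣n⇒∣m*n 4 (∣m⇒∣m*n (suc (2 * j)) p∣2j+1)))
        where
        p∣2j+1 : p ∣ suc (2 * j)
        p∣2j+1 = ∣m+n∣m⇒∣n p∣d+2j+1 p∣d
    split (no p∤d) = inj₂ (p²∣m*n⇒p²∣m pr p∤d (subst (p * p ∣_) (*-comm d _) p²∣product))

  private
    congruent-≤ : ∀ i d → p * p ∣ f i → p * p ∣ f (i + d) →
                  i % (p * p) ≡ (i + d) % (p * p) ⊎ (i + suc (i + d)) % (p * p) ≡ 0
    congruent-≤ i d p²∣fi p²∣fi+d with roots-apart i d p²∣fi p²∣fi+d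
    ... | inj₁ (divides q refl) = inj₁ (sym ([m+kn]%n≡m%n i q (p * p)))
    ... | inj₂ p²∣d+2i+1 = inj₂ (n∣m⇒m%n≡0 _ (p * p) (subst (p * p ∣_) (regroup i d) p²∣d+2i+1))
      where
      regroup : ∀ i d → d + suc (2 * i) ≡ i + suc (i + d)
      regroup = solve-∀

  roots-congruent : ∀ {i j} → p * p ∣ f i → p * p ∣ f j →
                    i % (p * p) ≡ j % (p * p) ⊎ (i + suc j) % (p * p) ≡ 0
  roots-congruent {i} {j} p²∣fi p²∣fj with ≤-total i j
  ... | inj₁ i≤j with j ∸ i | m+[n∸m]≡n i≤j
  ...   | d | refl = congruent-≤ i d p²∣fi p²∣fj
  roots-congruent {i} {j} p²∣fi p²∣fj | inj₂ j≤i with i ∸ j | m+[n∸m]≡n j≤i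
  ...   | d | refl with congruent-≤ j d p²∣fj p²∣fi
  ...     | inj₁ j≡i = inj₁ (sym j≡i)
  ...     | inj₂ j+i+1≡0 = inj₂ (trans (cong (_% (p * p)) (regroup j d)) j+i+1≡0)
    where
    regroup : ∀ j d → j + d + suc j ≡ j + suc (j + d)
    regroup = solve-∀

-- J / p² at odd p ≥ 5 and 0 elsewhere: p % 2 serves as the indicator of oddness.
oddShare : ℕ → ℕ → ℕ
oddShare J p@(suc (suc (suc (suc (suc _))))) = p % 2 * (J / (p * p))
oddShare J _ = 0

module _ (J : ℕ) where

  oddShare-odd : ∀ t → oddShare J (5 + 2 * t) ≡ J / ((5 + 2 * t) * (5 + 2 * t))
  oddShare-odd t = trans (cong (_* (J / ((5 + 2 * t) * (5 + 2 * t)))) parity) (*-identityˡ _)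
    where
    parity : (5 + 2 * t) % 2 ≡ 1
    parity = trans (cong (_% 2) (regroup t)) ([m+kn]%n≡m%n 1 (2 + t) 2)
      where
      regroup : ∀ t → 5 + 2 * t ≡ 1 + (2 + t) * 2
      regroup = solve-∀

  oddShare-even : ∀ t → oddShare J (6 + 2 * t) ≡ 0
  oddShare-even t = cong (_* (J / ((6 + 2 * t) * (6 + 2 * t)))) parity
    where
    parity : (6 + 2 * t) % 2 ≡ 0
    parity = trans (cong (_% 2) (regroup t)) ([m+kn]%n≡m%n 0 (3 + t) 2)
      where
      regroup : ∀ t → 6 + 2 * t ≡ 0 + (3 + t) * 2
      regroup = solve-∀

  ∑-oddShare-step : ∀ t → ∑ (5 + 2 * suc t) (oddShare J) ≡ ∑ (5 + 2 * t) (oddShare J) + J / ((5 + 2 * t) * (5 + 2 * t))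
  ∑-oddShare-step t = begin
    ∑ (5 + 2 * suc t) (oddShare J)                       ≡⟨ cong (λ n → ∑ n (oddShare J)) (regroup t) ⟩
    S + oddShare J (5 + 2 * t) + oddShare J (6 + 2 * t)  ≡⟨ cong₂ (λ a b → S + a + b) (oddShare-odd t) (oddShare-even t) ⟩
    S + J / ((5 + 2 * t) * (5 + 2 * t)) + 0              ≡⟨ +-identityʳ _ ⟩
    S + J / ((5 + 2 * t) * (5 + 2 * t))                  ∎
    where
    open ≡-Reasoning
    S = ∑ (5 + 2 * t) (oddShare J)
    regroup : ∀ t → 5 + 2 * suc t ≡ suc (suc (5 + 2 * t))
    regroup = solve-∀

  -- The bound Σ J/p² ≤ J/6 − J/(2(3 + 2t)) over odd 5 ≤ p < 5 + 2t, cleared of denominators;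
  -- the induction step is 1/p² ≤ (1/(p − 2) − 1/p)/2.
  oddShare-telescope : ∀ t → 6 * ∑ (5 + 2 * t) (oddShare J) * (3 + 2 * t) + 3 * J ≤ J * (3 + 2 * t)
  oddShare-telescope zero    = ≤-reflexive (*-comm 3 J)
  oddShare-telescope (suc t) =
    subst₂ (λ s n → 6 * s * n + 3 * J ≤ J * n) (sym (∑-oddShare-step t)) (sym (regroup t))
      (*-cancelˡ-≤ D (+-cancelʳ-≤ (3 * J * E) _ _ (begin
        D * (6 * (S + q) * E + 3 * J) + 3 * J * E  ≡⟨ expandˡ D S q J ⟩
        E * (6 * S * D + 3 * J) + 6 * (q * (D * E)) + 3 * J * D
          ≤⟨ +-monoˡ-≤ (3 * J * D) (+-mono-≤ (*-monoʳ-≤ E (oddShare-telescope t)) (*-monoʳ-≤ 6 q*DE≤J)) ⟩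
        E * (J * D) + 6 * J + 3 * J * D            ≡⟨ expandʳ D J ⟨
        D * (J * E) + 3 * J * E                    ∎)))
    where
    open ≤-Reasoning
    D = 3 + 2 * t
    E = 2 + D
    S = ∑ (5 + 2 * t) (oddShare J)
    q = J / ((5 + 2 * t) * (5 + 2 * t))
    regroup : ∀ t → 3 + 2 * suc t ≡ 2 + (3 + 2 * t)
    regroup = solve-∀
    q*DE≤J : q * (D * E) ≤ J
    q*DE≤J = ≤-trans (*-monoʳ-≤ q (*-monoˡ-≤ E (m≤n+m D 2))) (m/n*n≤m J (E * E))
    expandˡ : ∀ D S q J → D * (6 * (S + q) * (2 + D) + 3 * J) + 3 * J * (2 + D)
                        ≡ (2 + D) * (6 * S * D + 3 * J) + 6 * (q * (D * (2 + D))) + 3 * J * D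
    expandˡ = solve-∀
    expandʳ : ∀ D J → D * (J * (2 + D)) + 3 * J * (2 + D) ≡ (2 + D) * (J * D) + 6 * J + 3 * J * D
    expandʳ = solve-∀

  6∑oddShare≤J : ∀ n → 6 * ∑ n (oddShare J) ≤ J
  6∑oddShare≤J n = *-cancelʳ-≤ _ _ (3 + 2 * n) (begin
    6 * ∑ n (oddShare J) * (3 + 2 * n)            ≤⟨ *-monoˡ-≤ (3 + 2 * n) (*-monoʳ-≤ 6 (∑-mono-≤-range (oddShare J) n≤5+2n)) ⟩
    6 * ∑ (5 + 2 * n) (oddShare J) * (3 + 2 * n)  ≤⟨ m≤m+n _ (3 * J) ⟩
    6 * ∑ (5 + 2 * n) (oddShare J) * (3 + 2 * n) + 3 * J ≤⟨ oddShare-telescope n ⟩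
    J * (3 + 2 * n)                               ∎)
    where
    open ≤-Reasoning
    n≤5+2n : n ≤ 5 + 2 * n
    n≤5+2n = ≤-by (5 + n) (regroup n)
      where
      regroup : ∀ n → 5 + 2 * n ≡ n + (5 + n)
      regroup = solve-∀

PrimeSquare∣f : ℕ → ℕ → Set
PrimeSquare∣f p j = Prime p × p * p ∣ f j

primeSquare∣f? : ∀ p j → Dec (PrimeSquare∣f p j)
primeSquare∣f? p j = prime? p ×-dec (p * p ∣? f j)

rootCount : ℕ → ℕ → ℕ
rootCount J p = count (primeSquare∣f? p) J

module _ (J : ℕ) where

  rootCount≡0 : ∀ {p} → (∀ j → ¬ PrimeSquare∣f p j) → rootCount J p ≡ 0
  rootCount≡0 {p} none = ∑-zero J (λ j _ → 𝟙-no (primeSquare∣f? p j) (none j))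

  rootCount≡0⊎root : ∀ p → rootCount J p ≡ 0 ⊎ ∃[ r ] (r < J × PrimeSquare∣f p r)
  rootCount≡0⊎root p with rootCount J p in count≡
  ... | zero  = inj₁ refl
  ... | suc _ with ∑>0⇒ J (subst (0 <_) (sym count≡) z<s)
  ...   | r , r<J , 𝟙>0 = inj₂ (r , r<J , 𝟙>0⇒ (primeSquare∣f? p r) 𝟙>0)

  rootCount-small : ∀ {p} → Prime p → UnitMod6 p → rootCount J p ≤ 2 * oddShare J p + 2
  rootCount-small {p} pr u with unitMod6∧prime⇒5≤p pr u | rootCount≡0⊎root p
  ... | _ | inj₁ count≡0 = ≤-trans (≤-reflexive count≡0) z≤n
  ... | s≤s (s≤s (s≤s (s≤s (s≤s _)))) | inj₂ (r , _ , _ , p²∣fr) = begin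
    rootCount J p                                   ≤⟨ ∑-mono-≤ J (λ j _ → 𝟙-⊎ (congruent-to-r j) _ (residue? j) (mirror? j)) ⟩
    ∑ J (λ j → 𝟙 (residue? j) + 𝟙 (mirror? j))      ≡⟨ ∑-+ J _ _ ⟩
    count residue? J + count mirror? J              ≤⟨ +-mono-≤ (count-separated residue? residues-apart J) (count-separated mirror? mirrors-apart J) ⟩
    (J / M + 1) + (J / M + 1)                       ≡⟨ regroup (J / M) ⟩
    2 * (J / M) + 2                                 ≡⟨ cong (λ s → 2 * s + 2) (sym share≡) ⟩
    2 * oddShare J p + 2                            ∎
    where
    open ≤-Reasoning
    M = p * p
    residue? : ∀ j → Dec (j % M ≡ r % M)
    residue? j = j % M ≟ r % M
    mirror? : ∀ j → Dec ((j + suc r) % M ≡ 0)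
    mirror? j = (j + suc r) % M ≟ 0
    congruent-to-r : ∀ j → PrimeSquare∣f p j → j % M ≡ r % M ⊎ (j + suc r) % M ≡ 0
    congruent-to-r j (_ , p²∣fj) = roots-congruent pr (s≤s (s≤s (s≤s z≤n))) {j} {r} p²∣fj p²∣fr
    residues-apart : Separated M (λ j → j % M ≡ r % M)
    residues-apart i≡r j≡r = %-separated (trans i≡r (sym j≡r))
    mirrors-apart : Separated M (λ j → (j + suc r) % M ≡ 0)
    mirrors-apart i+r+1≡0 j+r+1≡0 = %-separated-shift (suc r) (trans i+r+1≡0 (sym j+r+1≡0))
    share≡ : oddShare J p ≡ J / M
    share≡ = trans (cong (_* (J / M)) (unitMod6⇒odd {p} u)) (*-identityˡ _)
    regroup : ∀ q → q + 1 + (q + 1) ≡ 2 * q + 2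
    regroup = solve-∀

  rootCount-large : ∀ {p} → Prime p → 2 < p → 2 * J ≤ p * p → rootCount J p ≤ 𝟙 (5 * p ≤? 9 * J)
  rootCount-large {p} pr 2<p 2J≤p² with rootCount≡0⊎root p
  ... | inj₁ count≡0 = ≤-trans (≤-reflexive count≡0) z≤n
  ... | inj₂ (r , r<J , _ , p²∣fr) = begin
    rootCount J p          ≤⟨ count≤1 (primeSquare∣f? p) J unique ⟩
    1                      ≡⟨ 𝟙-yes (5 * p ≤? 9 * J) 5p≤9J ⟨
    𝟙 (5 * p ≤? 9 * J)     ∎
    where
    open ≤-Reasoning
    instance
      p²≢0 : NonZero (p * p)
      p²≢0 = prime⇒p*p≢0 pr
    5p≤9J : 5 * p ≤ 9 * J
    5p≤9J = 5p²≤16J²⇒5p≤9J {p} {J} (≤-trans (p²∣f⇒5p²≤f {p} r p²∣fr) (f<16J² r<J))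
    J+J≤M : J + J ≤ p * p
    J+J≤M = subst (_≤ p * p) (cong (_+_ J) (+-identityʳ J)) 2J≤p²
    ¬two-roots : ∀ {i j} → i < j → j < J → p * p ∣ f i → p * p ∣ f j → ⊥
    ¬two-roots {i} {j} i<j j<J p²∣fi p²∣fj with roots-congruent pr 2<p {i} {j} p²∣fi p²∣fj
    ... | inj₁ i≡j = <⇒≱ (<-≤-trans j<J (≤-trans (m≤m+n J J) J+J≤M)) (≤-trans (m≤n+m (p * p) i) (%-separated i≡j i<j))
    ... | inj₂ i+j+1≡0 with m+n≡0⇒n≡0 i (trans (sym (m<n⇒m%n≡m (<-≤-trans (+-mono-<-≤ (<-trans i<j j<J) j<J) J+J≤M))) i+j+1≡0)
    ...   | ()
    unique : ∀ {i j} → i < J → j < J → PrimeSquare∣f p i → PrimeSquare∣f p j → i ≡ j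
    unique {i} {j} _ j<J (_ , p²∣fi) (_ , p²∣fj) with <-cmp i j
    ... | tri< i<j _ _ = ⊥-elim (¬two-roots i<j j<J p²∣fi p²∣fj)
    ... | tri≈ _ i≡j _ = i≡j
    unique {i} {j} i<J _ (_ , p²∣fi) (_ , p²∣fj) | tri> _ _ j<i = ⊥-elim (¬two-roots j<i i<J p²∣fj p²∣fi)

unitMod6? : ∀ p → Dec (UnitMod6 p)
unitMod6? p = (p % 6 ≟ 1) ⊎-dec (p % 6 ≟ 5)

count-unitMod6 : ∀ c → count unitMod6? (c * 6) ≤ c * 2
count-unitMod6 c = begin
  count unitMod6? (c * 6)                          ≤⟨ ∑-mono-≤ (c * 6) (λ n _ → 𝟙-⊎ id (unitMod6? n) (n % 6 ≟ 1) (n % 6 ≟ 5)) ⟩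
  ∑ (c * 6) (λ n → 𝟙 (n % 6 ≟ 1) + 𝟙 (n % 6 ≟ 5))  ≡⟨ ∑-+ (c * 6) _ _ ⟩
  count (λ n → n % 6 ≟ 1) (c * 6) + count (λ n → n % 6 ≟ 5) (c * 6)
    ≤⟨ +-mono-≤ (count-separated-multiple _ (residue-apart 1) c) (count-separated-multiple _ (residue-apart 5) c) ⟩
  c + c                                            ≡⟨ cong (_+_ c) (sym (+-identityʳ c)) ⟩
  2 * c                                            ≡⟨ *-comm 2 c ⟩
  c * 2                                            ∎
  where
  open ≤-Reasoning
  residue-apart : ∀ r → Separated 6 (λ n → n % 6 ≡ r)
  residue-apart r i≡r j≡r = %-separated (trans i≡r (sym j≡r))

primeBound : ℕ → ℕ → ℕ → ℕ
primeBound J R p = 2 * oddShare J p + 2 * 𝟙 (p <? R) + 𝟙 (unitMod6? p ×-dec (5 * p ≤? 9 * J))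

module _ (J R : ℕ) (2J≤R² : 2 * J ≤ R * R) where

  rootCount≤primeBound : ∀ p → rootCount J p ≤ primeBound J R p
  rootCount≤primeBound p = byPrimality (prime? p)
    where
    open ≤-Reasoning
    noRoots : (∀ j → ¬ PrimeSquare∣f p j) → rootCount J p ≤ primeBound J R p
    noRoots none = ≤-trans (≤-reflexive (rootCount≡0 J none)) z≤n
    bySize : Prime p → UnitMod6 p → Dec (p < R) → rootCount J p ≤ primeBound J R p
    bySize pr u (yes p<R) = begin
      rootCount J p                      ≤⟨ rootCount-small J pr u ⟩
      2 * oddShare J p + 2               ≡⟨ cong (λ b → 2 * oddShare J p + 2 * b) (𝟙-yes (p <? R) p<R) ⟨
      2 * oddShare J p + 2 * 𝟙 (p <? R)  ≤⟨ m≤m+n _ _ ⟩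
      primeBound J R p                   ∎
    bySize pr u (no p≮R) = begin
      rootCount J p                                  ≤⟨ rootCount-large J pr 2<p 2J≤p² ⟩
      𝟙 (5 * p ≤? 9 * J)                             ≤⟨ 𝟙≤𝟙 (u ,_) (5 * p ≤? 9 * J) (unitMod6? p ×-dec (5 * p ≤? 9 * J)) ⟩
      𝟙 (unitMod6? p ×-dec (5 * p ≤? 9 * J))         ≤⟨ m≤n+m _ _ ⟩
      primeBound J R p                               ∎
      where
      2<p : 2 < p
      2<p = <-≤-trans (s≤s (s≤s (s≤s z≤n))) (unitMod6∧prime⇒5≤p pr u)
      2J≤p² : 2 * J ≤ p * p
      2J≤p² = ≤-trans 2J≤R² (*-mono-≤ (≮⇒≥ p≮R) (≮⇒≥ p≮R))
    byPrimality : Dec (Prime p) → rootCount J p ≤ primeBound J R p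
    byPrimality (no ¬prime) = noRoots (λ j psd → ¬prime (proj₁ psd))
    byPrimality (yes pr) with prime-mod6 pr
    ... | inj₁ p≡2 = noRoots (λ j psd → 2∤f j (∣-trans (subst (λ q → 2 ∣ q * q) (sym p≡2) (divides 2 refl)) (proj₂ psd)))
    ... | inj₂ (inj₁ p≡3) = noRoots (λ j psd → 3∤f j (∣-trans (subst (λ q → 3 ∣ q * q) (sym p≡3) (divides 3 refl)) (proj₂ psd)))
    ... | inj₂ (inj₂ u) = bySize pr u (p <? R)

  ∑-rootCount≤ : ∀ B c → (∀ p → 5 * p ≤ 9 * J → p < c * 6) → 6 * ∑ B (rootCount J) ≤ 2 * J + 12 * R + 12 * c
  ∑-rootCount≤ B c small = begin
    6 * ∑ B (rootCount J)                     ≤⟨ *-monoʳ-≤ 6 (∑-mono-≤ B (λ p _ → rootCount≤primeBound p)) ⟩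
    6 * ∑ B (primeBound J R)                  ≡⟨ cong (_*_ 6) split ⟩
    6 * (2 * shares + 2 * belowR + large)     ≡⟨ regroup shares belowR large ⟩
    2 * (6 * shares) + 12 * belowR + 6 * large
      ≤⟨ +-mono-≤ (+-mono-≤ (*-monoʳ-≤ 2 (6∑oddShare≤J J B)) (*-monoʳ-≤ 12 (count-<-≤ R B))) (*-monoʳ-≤ 6 large≤2c) ⟩
    2 * J + 12 * R + 6 * (c * 2)              ≡⟨ cong (_+_ (2 * J + 12 * R)) (6[2c]≡12c c) ⟩
    2 * J + 12 * R + 12 * c                   ∎
    where
    open ≤-Reasoning
    large? : ∀ p → Dec (UnitMod6 p × 5 * p ≤ 9 * J)
    large? p = unitMod6? p ×-dec (5 * p ≤? 9 * J)
    shares = ∑ B (oddShare J)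
    belowR = count (_<? R) B
    large = count large? B
    split : ∑ B (primeBound J R) ≡ 2 * shares + 2 * belowR + large
    split = trans (∑-+ B _ _) (cong (_+ large) (trans (∑-+ B _ _)
              (cong₂ _+_ (∑-*ˡ B 2 (oddShare J)) (∑-*ˡ B 2 (λ p → 𝟙 (p <? R))))))
    regroup : ∀ x y z → 6 * (2 * x + 2 * y + z) ≡ 2 * (6 * x) + 12 * y + 6 * z
    regroup = solve-∀
    6[2c]≡12c : ∀ c → 6 * (c * 2) ≡ 12 * c
    6[2c]≡12c = solve-∀
    large≤2c : large ≤ c * 2
    large≤2c = begin
      count large? B           ≤⟨ ∑-truncate B (c * 6) _ (λ p c6≤p → 𝟙-no (large? p) (λ l → <⇒≱ (small p (proj₂ l)) c6≤p)) ⟩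
      count large? (c * 6)     ≤⟨ ∑-mono-≤ (c * 6) (λ p _ → 𝟙≤𝟙 proj₁ (large? p) (unitMod6? p)) ⟩
      count unitMod6? (c * 6)  ≤⟨ count-unitMod6 c ⟩
      c * 2                    ∎

-- Infinitely many square-free values

primeSquareFree⇒SquareFree : ∀ n .{{_ : NonZero n}} → (∀ p → Prime p → ¬ p * p ∣ n) → SquareFree n
primeSquareFree⇒SquareFree n no-p² zero 0∣n = ⊥-elim (≢-nonZero⁻¹ n (0∣⇒≡0 0∣n))
primeSquareFree⇒SquareFree n no-p² 1 _ = refl
primeSquareFree⇒SquareFree n no-p² d@(suc (suc _)) d²∣n with factorise d
... | record { factors = [] ; isFactorisation = () }
... | record { factors = p ∷ ps ; isFactorisation = d≡p*ps ; factorsPrime = pr ∷ _ } =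
  ⊥-elim (no-p² p pr (∣-trans (*-pres-∣ p∣d p∣d) d²∣n))
  where
  p∣d : p ∣ d
  p∣d = divides (product ps) (trans d≡p*ps (*-comm p _))

module _ {K J R c : ℕ} (2J≤R² : 2 * J ≤ R * R) (large-below : ∀ p → 5 * p ≤ 9 * J → p < c * 6)
         (budget : 2 * J + 12 * R + 12 * c + 6 * K < 6 * J) where
  private
    B = suc (16 * (J * J))

    bad : ℕ → ℕ
    bad j = count (λ p → primeSquare∣f? p j) B

    ∑bad+K<J : ∑ J bad + K < J
    ∑bad+K<J = scaled (∑ J bad) K _ J counted budget
      where
      open ≤-Reasoning
      counted : 6 * ∑ J bad ≤ 2 * J + 12 * R + 12 * c
      counted = begin
        6 * ∑ J bad              ≡⟨ cong (6 *_) (∑-swap J B (λ j p → 𝟙 (primeSquare∣f? p j))) ⟩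
        6 * ∑ B (rootCount J)    ≤⟨ ∑-rootCount≤ J R 2J≤R² B c large-below ⟩
        2 * J + 12 * R + 12 * c  ∎
      -- Stated for variables s and b: elaborating this chain directly at s = ∑ J bad is very slow.
      scaled : ∀ s K b J → 6 * s ≤ b → b + 6 * K < 6 * J → s + K < J
      scaled s K b J 6s≤b b+6K<6J = *-cancelˡ-< 6 (s + K) J (begin-strict
        6 * (s + K)    ≡⟨ *-distribˡ-+ 6 s K ⟩
        6 * s + 6 * K  ≤⟨ +-monoˡ-≤ (6 * K) 6s≤b ⟩
        b + 6 * K      <⟨ b+6K<6J ⟩
        6 * J          ∎)

  ∃-squarefree-f-between : ∃[ j ] (K ≤ j × j < J × SquareFree (f j))
  ∃-squarefree-f-between = squarefree-at (∃-zero-beyond K J bad ∑bad+K<J)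
    where
    squarefree-at : ∃[ j ] (K ≤ j × j < J × bad j ≡ 0) → ∃[ j ] (K ≤ j × j < J × SquareFree (f j))
    squarefree-at (j , K≤j , j<J , bad≡0) = j , K≤j , j<J , primeSquareFree⇒SquareFree (f j) {{f≢0 j}} no-p²
      where
      no-p² : ∀ p → Prime p → ¬ p * p ∣ f j
      no-p² p pr p²∣fj = 1+n≢0 (trans (sym (𝟙-yes (primeSquare∣f? p j) (pr , p²∣fj))) (∑≡0⇒ B bad≡0 p p<B))
        where
        p<B : p < B
        p<B = s≤s (≤-trans (m≤m*n p p {{prime⇒nonZero pr}}) (≤-trans (∣⇒≤ {{f≢0 j}} p²∣fj) (f<16J² j<J)))

counting-budget : ∀ K U → U ≡ 31 + 2 * K →
                  2 * (5 * U * (5 * U)) + 12 * (10 * U) + 12 * (8 * (U * U) + 1) + 6 * K < 6 * (5 * U * (5 * U))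
counting-budget K .(31 + 2 * K) refl = <-by (111 + 250 * K + 16 * (K * K)) (expand K)
  where
  expand : ∀ K → 6 * (5 * (31 + 2 * K) * (5 * (31 + 2 * K)))
           ≡ 2 * (5 * (31 + 2 * K) * (5 * (31 + 2 * K))) + 12 * (10 * (31 + 2 * K))
             + 12 * (8 * ((31 + 2 * K) * (31 + 2 * K)) + 1) + 6 * K + suc (111 + 250 * K + 16 * (K * K))
  expand = solve-∀

-- U is kept a variable: with U = 31 + 2K substituted, unification normalises J, R and c
-- into unary numerals, which is infeasible.
∃-squarefree-f-beyond : ∀ K U → U ≡ 31 + 2 * K → ∃[ j ] (K ≤ j × SquareFree (f j))
∃-squarefree-f-beyond K U U≡31+2K =
  forget-bound (∃-squarefree-f-between {K} {J} {R} {c} 2J≤R² large-below (counting-budget K U U≡31+2K))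
  where
  J = 5 * U * (5 * U)
  R = 10 * U
  c = 8 * (U * U) + 1
  2J≤R² : 2 * J ≤ R * R
  2J≤R² = ≤-by (50 * (U * U)) (expand U)
    where
    expand : ∀ U → 10 * U * (10 * U) ≡ 2 * (5 * U * (5 * U)) + 50 * (U * U)
    expand = solve-∀
  large-below : ∀ p → 5 * p ≤ 9 * J → p < c * 6
  large-below p 5p≤9J = ≤-<-trans (*-cancelˡ-≤ 5 (≤-trans 5p≤9J (≤-reflexive (expand U)))) (<-by (3 * (U * U) + 5) (expand′ U))
    where
    expand : ∀ U → 9 * (5 * U * (5 * U)) ≡ 5 * (45 * (U * U))
    expand = solve-∀
    expand′ : ∀ U → (8 * (U * U) + 1) * 6 ≡ 45 * (U * U) + suc (3 * (U * U) + 5)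
    expand′ = solve-∀
  forget-bound : ∃[ j ] (K ≤ j × j < J × SquareFree (f j)) → ∃[ j ] (K ≤ j × SquareFree (f j))
  forget-bound (j , K≤j , _ , squarefree) = j , K≤j , squarefree

fundamentalUnit-4a²+1 : ∀ a → 2 ≤ a →
                        IsFundamentalUnit (4 * (a * a) + 1) (+ (2 * (2 * a))) (+ 2) × InZ√ (+ (2 * (2 * a))) (+ 2)
fundamentalUnit-4a²+1 a 2≤a =
  subst (λ N → IsFundamentalUnit N (+ (2 * (2 * a))) (+ 2)) (square-of-double a) (fundamentalUnit (2 * a) 3≤2a) ,
  divides (2 * a) (*-comm 2 (2 * a)) , divides 1 refl
  where
  3≤2a : 3 ≤ 2 * a
  3≤2a = ≤-trans (m≤m+n 3 1) (*-monoʳ-≤ 2 2≤a)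
  square-of-double : ∀ a → 2 * a * (2 * a) + 1 ≡ 4 * (a * a) + 1
  square-of-double = solve-∀

mainTheorem6 : ∀ (m : ℕ) → ∃[ a ] (m < a × a % 2 ≡ 1 × 3 < a
                 × SquareFree (4 * (a * a) + 1)
                 × ∃[ x ] ∃[ y ] (IsFundamentalUnit (4 * (a * a) + 1) x y × InZ√ x y))
mainTheorem6 m = odd-witness (∃-squarefree-f-beyond (m + 2) (31 + 2 * (m + 2)) refl)
  where
  odd-witness : ∃[ j ] (m + 2 ≤ j × SquareFree (f j)) →
                ∃[ a ] (m < a × a % 2 ≡ 1 × 3 < a × SquareFree (4 * (a * a) + 1)
                        × ∃[ x ] ∃[ y ] (IsFundamentalUnit (4 * (a * a) + 1) x y × InZ√ x y))
  odd-witness (j , m+2≤j , squarefree) =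
    a , m<a , a-odd , 3<a , squarefree , + (2 * (2 * a)) , + 2 , fundamentalUnit-4a²+1 a (≤-trans (n≤1+n 2) (<⇒≤ 3<a))
    where
    a = suc (2 * j)
    2≤j : 2 ≤ j
    2≤j = ≤-trans (m≤n+m 2 m) m+2≤j
    m<a : m < a
    m<a = s≤s (≤-trans (m≤m+n m 2) (≤-trans m+2≤j (m≤m+n j (j + 0))))
    a-odd : a % 2 ≡ 1
    a-odd = trans (cong (λ n → suc n % 2) (*-comm 2 j)) ([m+kn]%n≡m%n 1 j 2)
    3<a : 3 < a
    3<a = s≤s (≤-trans (m≤m+n 3 1) (*-monoʳ-≤ 2 2≤j))
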